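{- For any path $P_n$ with $n\geq 3$, $\mathrm{th}^*_{\mathrm{H}}(P_n)=\left\lceil\frac{n+1}{2}\right\rceil$, i.e., it equals $\frac{n+1}{2}$ if $n$ is odd and $\frac{n+2}{2}$ if $n$ is even.
   Context: All graphs are finite, simple and undirected; $N(v)$ is the open neighborhood of $v$. Vertices are colored blue or white. Under the hopping color change rule, a blue vertex $v$ may force a white vertex $w$ (not necessarily adjacent to $v$) to become blue provided $v$ has not previously performed a force and every vertex of $N(v)$ is blue. Starting from an initial blue set $B\subseteq V(G)$, a chronological list of forces is a sequence of valid forces performed one at a time until no further force is possible; its unordered set of forces is a set of forces of $B$. $B$ is a hopping forcing set if some chronological list turns every vertex blue; $\mathrm{H}(G)$ is the minimum size of a hopping forcing set. For a set of forces $\mathcal F$ of $B$, put $\mathcal F^{(0)}=B$ and, for $t>0$, let $\mathcal F^{(t)}$ be the set of vertices $w$ for which there is a force $v\to w$ in $\mathcal F$ with $v\in\bigcup_{i<t}\mathcal F^{(i)}$ that is a valid hopping force when exactly the vertices of $\bigcup_{i<t}\mathcal F^{(i)}$ are blue. $\mathrm{pt}_{\mathrm{H}}(G;\mathcal F)$ is the least $t$ with $\bigcup_{i\le t}\mathcal F^{(i)}=V(G)$, and $\mathrm{pt}_{\mathrm{H}}(G;B)$ is the minimum of $\mathrm{pt}_{\mathrm{H}}(G;\mathcal F)$ over sets of forces $\mathcal F$ of $B$ ($\infty$ if $B$ is not a hopping forcing set). For an integer $k$, $\mathrm{pt}_{\mathrm{H}}(G,k)=\min\{\mathrm{pt}_{\mathrm{H}}(G;B):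 B\subseteq V(G),\ |B|=k\}$. The product hopping throttling number without initial cost is $\mathrm{th}^*_{\mathrm{H}}(G)=\min_{\mathrm{H}(G)\leq k<|V(G)|}\{k\cdot \mathrm{pt}_{\mathrm{H}}(G,k)\}$. -}

module Defs where

open import Data.Nat using (ℕ; zero; suc; _+_; _*_; _≤_; _<_)
open import Data.Nat.Properties using (<-irrefl; n<1+n)
open import Data.Fin using (Fin; toℕ)
open import Data.Fin.Subset using (Subset; _∈_; _∉_; ∣_∣)
open import Data.List using (List; []; _∷_; map)
open import Data.List.Membership.Propositional renaming (_∈_ to _∈L_)
open import Data.Product using (Σ; ∃; ∃-syntax; _×_; _,_; proj₁; proj₂)
open import Data.Sum using (_⊎_; inj₁; inj₂)
open import Relation.Nullary using (¬_)
open import Relation.Binary.PropositionalEquality using (_≡_; sym)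
open import Function.Bundles using (_⇔_)

record Graph : Set₁ where
  field
    order : ℕ
    Adj   : Fin order → Fin order → Set
    Adj-sym   : ∀ {u v} → Adj u v → Adj v u
    Adj-irrefl : ∀ {u} → ¬ Adj u u

open Graph public

pathGraph : ℕ → Graph
pathGraph n = record
  { order = n
  ; Adj = λ i j → (suc (toℕ i) ≡ toℕ j) ⊎ (suc (toℕ j) ≡ toℕ i)
  ; Adj-sym = λ { (inj₁ p) → inj₂ p ; (inj₂ p) → inj₁ p }
  ; Adj-irrefl = λ { (inj₁ p) → <-irrefl (sym p) (n<1+n _) ; (inj₂ p) → <-irrefl (sym p) (n<1+n _) }
  }

module _ (G : Graph) where
  private
    V = Fin (order G)

  -- a force v → w is the pair (v , w)
  Force : Set
  Force = V × V

  -- A chronological list is stored newest-force-first.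
  -- Blue vertices after performing the forces in L starting from B.
  Blue : Subset (order G) → List Force → V → Set
  Blue B L x = (x ∈ B) ⊎ (x ∈L map proj₂ L)

  HasForced : List Force → V → Set
  HasForced L v = v ∈L map proj₁ L

  ValidForce : Subset (order G) → List Force → V → V → Set
  ValidForce B L v w =
    Blue B L v × ¬ HasForced L v × ¬ Blue B L w × (∀ u → Adj G v u → Blue B L u)

  data IsForceSeq (B : Subset (order G)) : List Force → Set where
    []  : IsForceSeq B []
    _∷_ : ∀ {L v w} → ValidForce B L v w → IsForceSeq B L → IsForceSeq B ((v , w) ∷ L)

  IsChronList : Subset (order G) → List Force → Set
  IsChronList B L = IsForceSeq B L × (∀ v w → ¬ ValidForce B L v w)

  IsSetOfForces : Subset (order G) → List Force → Set
  IsSetOfForces B F = ∃[ L ] (IsChronList B L × (∀ f → (f ∈L F) ⇔ (f ∈L L)))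

  IsHoppingForcingSet : Subset (order G) → Set
  IsHoppingForcingSet B = ∃[ L ] (IsChronList B L × (∀ x → Blue B L x))

  InUpTo : Subset (order G) → List Force → ℕ → V → Set
  InUpTo B F zero    x = x ∈ B
  InUpTo B F (suc t) x =
    InUpTo B F t x ⊎
    (∃[ v ] (((v , x) ∈L F) × InUpTo B F t v × ¬ InUpTo B F t x
             × (∀ u → Adj G v u → InUpTo B F t u)))

  IsMin : (ℕ → Set) → ℕ → Set
  IsMin P m = P m × (∀ x → P x → m ≤ x)

  PtForces : Subset (order G) → List Force → ℕ → Set
  PtForces B F = IsMin (λ t → ∀ x → InUpTo B F t x)

  PtSet : Subset (order G) → ℕ → Set
  PtSet B = IsMin (λ t → ∃[ F ] (IsSetOfForces B F × PtForces B F t))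

  PtK : ℕ → ℕ → Set
  PtK k = IsMin (λ t → ∃[ B ] ((∣ B ∣ ≡ k) × PtSet B t))

  HNum : ℕ → Set
  HNum = IsMin (λ k → ∃[ B ] ((∣ B ∣ ≡ k) × IsHoppingForcingSet B))

  -- th*_H(G) = m : minimum of k · pt_H(G,k) over H(G) ≤ k < |V(G)|
  -- (values k with pt_H(G,k) = ∞ contribute ∞ and are skipped)
  ThStarH : ℕ → Set
  ThStarH = IsMin (λ x → ∃[ k ] ∃[ h ] ∃[ t ]
                     (HNum h × h ≤ k × k < order G × PtK k t × x ≡ k * t))

{-# OPTIONS --safe #-}
-- The lower bound k · t ≥ (n + 1)/2 for k < n blue vertices and propagation time t is a
-- counting argument. Every vertex lies at depth d ≤ t on a forcing chain starting in B, and it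
-- is determined by d and the start, because each vertex forces at most once; so n ≤ (t + 1) k, which for t ≥ 2
-- already gives 2kt ≥ n + 1. For t = 1 the vertices outside B have distinct forcers in B, and
-- since the path is connected some vertex of B has a white neighbour and cannot force, so
-- n − k ≤ k − 1. The bound is attained by the first ⌈(n + 1)/2⌉ vertices, which force
-- i → ⌈(n + 1)/2⌉ + i all in one round, while H(P_n) = 2 keeps this k admissible.
module Submission where

open import Defs
open import Data.Nat using (ℕ; suc; _≤_; ⌈_/2⌉)
open import Data.Nat using (zero; _+_; _*_; _∸_; _<_; z≤n; s≤s; s≤s⁻¹; _<?_)
open import Data.Nat.Properties
  using ( ≤-refl; ≤-reflexive; ≤-trans; <-trans; ≤-<-trans; <-irrefl; <⇒≤; <⇒≱; ≮⇒≥; n≮0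
        ; n≤1+n; n<1+n; m≤n⇒m≤1+n; m≤n⇒m<n∨m≡n; m≤m+n; m≤n+m; m≤n+m∸n; m+[n∸m]≡n
        ; +-comm; +-suc; +-identityʳ; *-identityʳ; *-zeroʳ
        ; +-mono-≤; +-monoˡ-≤; +-monoʳ-≤; +-monoʳ-<; +-cancelʳ-≤
        ; ⌈n/2⌉-mono; ⌈n/2⌉≤n; ⌊n/2⌋≤⌈n/2⌉; ⌊n/2⌋+⌈n/2⌉≡n; n≡⌈n+n/2⌉; module ≤-Reasoning)
open import Data.Nat.Tactic.RingSolver using (solve-∀)
open import Data.Fin using (Fin; zero; suc; toℕ; fromℕ<; inject₁; combine)
open import Data.Fin.Properties
  using (toℕ-fromℕ<; fromℕ<-injective; toℕ-inject₁; toℕ-injective; toℕ<n; combine-injective; ¬∀⟶∃¬)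
  renaming (suc-injective to Fin-suc-injective; 0≢1+n to Fin-0≢1+n)
open import Data.Fin.Subset using (Subset; _∈_; _∉_; ∣_∣; ⊤; ∁; _-_; inside; outside)
open import Data.Fin.Subset.Properties
  using (_∈?_; ∣⊤∣≡n; ∣∁p∣≡n∸∣p∣; x∈p∧x≢y⇒x∈p-y; x∈p⇒∣p-x∣<∣p∣; x∈∁p⇒x∉p)
open import Data.Vec using ([]; _∷_; _++_; concat; replicate; lookup)
open import Data.Vec.Properties using (lookup-concat; lookup-replicate; lookup⇒[]=; []=⇒lookup)
open import Data.Vec.Base using (_[_]=_)
open _[_]=_
open import Data.List using (List; []; _∷_; map)
open import Data.List.Relation.Unary.Any using (here; there)
open import Data.List.Membership.Propositional using () renaming (_∈_ to _∈L_)
open import Data.List.Membership.Propositional.Properties using (∈-map⁺)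
open import Data.Product using (∃-syntax; ∃₂; _×_; _,_; proj₁; proj₂)
open import Data.Sum using (inj₁; inj₂)
open import Function using (_∘_; id)
open import Function.Bundles using (Equivalence; mk⇔)
open import Relation.Nullary using (¬_; yes; no; contradiction)
open import Relation.Nullary.Decidable using (¬?; decidable-stable)
open import Relation.Unary using (Pred; Decidable)
open import Relation.Binary.PropositionalEquality
  using (_≡_; _≢_; refl; sym; trans; cong; subst; module ≡-Reasoning)

injective⇒∣p∣≤∣q∣ : ∀ {m n} {p : Subset m} {q : Subset n} (f : ∀ x → x ∈ p → Fin n) →
  (∀ x px → f x px ∈ q) → (∀ x y px py → f x px ≡ f y py → x ≡ y) → ∣ p ∣ ≤ ∣ q ∣
injective⇒∣p∣≤∣q∣ {p = []} _ _ _ = z≤n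
injective⇒∣p∣≤∣q∣ {p = outside ∷ p} f into inj =
  injective⇒∣p∣≤∣q∣ (λ x px → f (suc x) (there px)) (λ x px → into (suc x) (there px))
    (λ x y px py → Fin-suc-injective ∘ inj (suc x) (suc y) (there px) (there py))
injective⇒∣p∣≤∣q∣ {p = inside ∷ p} {q} f into inj = ≤-trans (s≤s rest) (x∈p⇒∣p-x∣<∣p∣ (into zero here))
  where
  rest : ∣ p ∣ ≤ ∣ q - f zero here ∣
  rest = injective⇒∣p∣≤∣q∣ (λ x px → f (suc x) (there px))
    (λ x px → x∈p∧x≢y⇒x∈p-y (into (suc x) (there px)) (Fin-0≢1+n ∘ inj zero (suc x) here (there px) ∘ sym))
    (λ x y px py → Fin-suc-injective ∘ inj (suc x) (suc y) (there px) (there py))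

full⇒n≤∣p∣ : ∀ {n} {p : Subset n} → (∀ x → x ∈ p) → n ≤ ∣ p ∣
full⇒n≤∣p∣ {n} {p} all =
  subst (_≤ ∣ p ∣) (∣⊤∣≡n n) (injective⇒∣p∣≤∣q∣ {p = ⊤} (λ x _ → x) (λ x _ → all x) (λ _ _ _ _ e → e))

∣p∣<n⇒¬full : ∀ {n} {p : Subset n} → ∣ p ∣ < n → ¬ (∀ x → x ∈ p)
∣p∣<n⇒¬full ∣p∣<n = <⇒≱ ∣p∣<n ∘ full⇒n≤∣p∣

distinct∈⇒2≤∣p∣ : ∀ {n} {p : Subset n} {x y} → x ∈ p → y ∈ p → x ≢ y → 2 ≤ ∣ p ∣
distinct∈⇒2≤∣p∣ x∈p y∈p x≢y =
  ≤-trans (s≤s (≤-trans (s≤s z≤n) (x∈p⇒∣p-x∣<∣p∣ (x∈p∧x≢y⇒x∈p-y y∈p (x≢y ∘ sym))))) (x∈p⇒∣p-x∣<∣p∣ x∈p)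

∣p++q∣≡∣p∣+∣q∣ : ∀ {m n} (p : Subset m) (q : Subset n) → ∣ p ++ q ∣ ≡ ∣ p ∣ + ∣ q ∣
∣p++q∣≡∣p∣+∣q∣ [] q = refl
∣p++q∣≡∣p∣+∣q∣ (inside ∷ p) q = cong suc (∣p++q∣≡∣p∣+∣q∣ p q)
∣p++q∣≡∣p∣+∣q∣ (outside ∷ p) q = ∣p++q∣≡∣p∣+∣q∣ p q

∣concat-replicate∣ : ∀ m {n} (q : Subset n) → ∣ concat (replicate m q) ∣ ≡ m * ∣ q ∣
∣concat-replicate∣ zero q = refl
∣concat-replicate∣ (suc m) q =
  trans (∣p++q∣≡∣p∣+∣q∣ q _) (cong (∣ q ∣ +_) (∣concat-replicate∣ m q))

combine∈concat-replicate : ∀ {m n} {q : Subset n} (i : Fin m) {x} → x ∈ q → combine i x ∈ concat (replicate m q)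
combine∈concat-replicate {m} {q = q} i {x} x∈q = lookup⇒[]= _ _ (begin
  lookup (concat (replicate m q)) (combine i x) ≡⟨ lookup-concat (replicate m q) i x ⟩
  lookup (lookup (replicate m q) i) x         ≡⟨ cong (λ r → lookup r x) (lookup-replicate i q) ⟩
  lookup q x                                   ≡⟨ []=⇒lookup x∈q ⟩
  inside                                       ∎)
  where open ≡-Reasoning

module _ {G : Graph} where
  private
    V = Fin (order G)

  Functional : List (Force G) → Set
  Functional F = ∀ {v x y} → (v , x) ∈L F → (v , y) ∈L F → x ≡ y

  forceSeq-functional : ∀ {B L} → IsForceSeq G B L → Functional L
  forceSeq-functional (_ ∷ _)                (here refl) (here refl) = refl
  forceSeq-functional ((_ , fresh , _) ∷ _)  (here refl) (there m)   = contradiction (∈-map⁺ proj₁ m) fresh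
  forceSeq-functional ((_ , fresh , _) ∷ _)  (there m)   (here refl) = contradiction (∈-map⁺ proj₁ m) fresh
  forceSeq-functional (_ ∷ seq)              (there m)   (there m′)  = forceSeq-functional seq m m′

  setOfForces-functional : ∀ {B F} → IsSetOfForces G B F → Functional F
  setOfForces-functional (L , (seq , _) , F≈L) m m′ =
    forceSeq-functional seq (Equivalence.to (F≈L _) m) (Equivalence.to (F≈L _) m′)

  data Chain (F : List (Force G)) (b : V) : ℕ → V → Set where
    []  : Chain F b 0 b
    _▷_ : ∀ {d v x} → Chain F b d v → (v , x) ∈L F → Chain F b (suc d) x

  chain-deterministic : ∀ {F b d x y} → Functional F → Chain F b d x → Chain F b d y → x ≡ y
  chain-deterministic fun [] [] = refl
  chain-deterministic fun (c ▷ m) (c′ ▷ m′) with refl ← chain-deterministic fun c c′ = fun m m′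

  Origin : Subset (order G) → List (Force G) → ℕ → V → Set
  Origin B F t x = ∃[ b ] ∃[ d ] (b ∈ B × d ≤ t × Chain F b d x)

  inUpTo⇒origin : ∀ {B F} t {x} → InUpTo G B F t x → Origin B F t x
  inUpTo⇒origin zero    x∈B = _ , 0 , x∈B , z≤n , []
  inUpTo⇒origin (suc t) (inj₁ x∈U) =
    let b , d , b∈B , d≤t , c = inUpTo⇒origin t x∈U in b , d , b∈B , m≤n⇒m≤1+n d≤t , c
  inUpTo⇒origin (suc t) (inj₂ (_ , m , v∈U , _)) =
    let b , d , b∈B , d≤t , c = inUpTo⇒origin t v∈U in b , suc d , b∈B , s≤s d≤t , c ▷ m

  originLabel : ∀ {B F t x} → Origin B F t x → Fin (suc t * order G)
  originLabel (b , d , _ , d≤t , _) = combine (fromℕ< (s≤s d≤t)) b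

  originLabel∈layers : ∀ {B F t x} (o : Origin B F t x) → originLabel o ∈ concat (replicate (suc t) B)
  originLabel∈layers (_ , _ , b∈B , d≤t , _) = combine∈concat-replicate (fromℕ< (s≤s d≤t)) b∈B

  originLabel-injective : ∀ {B F t x y} → Functional F → (o : Origin B F t x) (o′ : Origin B F t y) →
    originLabel o ≡ originLabel o′ → x ≡ y
  originLabel-injective fun (b , d , _ , d≤t , c) (b′ , d′ , _ , d′≤t , c′) e
    with combine-injective _ b _ b′ e
  ... | same-layer , refl with refl ← fromℕ<-injective d d′ (s≤s d≤t) (s≤s d′≤t) same-layer =
    chain-deterministic fun c c′

  order≤rounds*∣B∣ : ∀ {B F t} → IsSetOfForces G B F → (∀ x → InUpTo G B F t x) → order G ≤ suc t * ∣ B ∣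
  order≤rounds*∣B∣ {B} {F} {t} sof covered = begin
    order G                          ≡⟨ ∣⊤∣≡n (order G) ⟨
    ∣ ⊤ {order G} ∣                  ≤⟨ labels-injective ⟩
    ∣ concat (replicate (suc t) B) ∣ ≡⟨ ∣concat-replicate∣ (suc t) B ⟩
    suc t * ∣ B ∣                    ∎
    where
    open ≤-Reasoning
    origin : ∀ x → Origin B F t x
    origin x = inUpTo⇒origin t (covered x)
    labels-injective : ∣ ⊤ {order G} ∣ ≤ ∣ concat (replicate (suc t) B) ∣
    labels-injective = injective⇒∣p∣≤∣q∣ {p = ⊤} {q = concat (replicate (suc t) B)} (λ x _ → originLabel (origin x))
      (λ x _ → originLabel∈layers (origin x))
      (λ x y _ _ → originLabel-injective (setOfForces-functional sof) (origin x) (origin y))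

  RoundOneForcer : Subset (order G) → List (Force G) → V → Set
  RoundOneForcer B F x = ∃[ v ] ((v , x) ∈L F × v ∈ B × (∀ u → Adj G v u → u ∈ B))

  roundOneForcer : ∀ {B F x} → InUpTo G B F 1 x → x ∉ B → RoundOneForcer B F x
  roundOneForcer (inj₁ x∈B)                      x∉B = contradiction x∈B x∉B
  roundOneForcer (inj₂ (v , m , v∈B , _ , nbrs)) _   = v , m , v∈B , nbrs

  roundOneForcer-injective : ∀ {B F x y} → Functional F →
    (f : RoundOneForcer B F x) (f′ : RoundOneForcer B F y) → proj₁ f ≡ proj₁ f′ → x ≡ y
  roundOneForcer-injective fun (_ , m , _) (_ , m′ , _) refl = fun m m′

  order<∣B∣+∣B∣ : ∀ {B F b u} → IsSetOfForces G B F → (∀ x → InUpTo G B F 1 x) →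
    b ∈ B → Adj G b u → u ∉ B → order G < ∣ B ∣ + ∣ B ∣
  order<∣B∣+∣B∣ {B} {F} {b} {u} sof covered b∈B adj u∉B = begin-strict
    order G                   ≤⟨ m≤n+m∸n (order G) ∣ B ∣ ⟩
    ∣ B ∣ + (order G ∸ ∣ B ∣) ≡⟨ cong (∣ B ∣ +_) (∣∁p∣≡n∸∣p∣ B) ⟨
    ∣ B ∣ + ∣ ∁ B ∣           ≤⟨ +-monoʳ-≤ ∣ B ∣ forcers-injective ⟩
    ∣ B ∣ + ∣ B - b ∣         <⟨ +-monoʳ-< ∣ B ∣ (x∈p⇒∣p-x∣<∣p∣ b∈B) ⟩
    ∣ B ∣ + ∣ B ∣             ∎
    where
    open ≤-Reasoning
    forcer : ∀ x → x ∈ ∁ B → RoundOneForcer B F x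
    forcer x x∈∁B = roundOneForcer (covered x) (x∈∁p⇒x∉p x∈∁B)
    forcer≢b : ∀ {x} (f : RoundOneForcer B F x) → proj₁ f ∈ B - b
    forcer≢b (_ , _ , v∈B , nbrs) = x∈p∧x≢y⇒x∈p-y v∈B (λ { refl → u∉B (nbrs u adj) })
    forcers-injective : ∣ ∁ B ∣ ≤ ∣ B - b ∣
    forcers-injective = injective⇒∣p∣≤∣q∣ {p = ∁ B} {q = B - b} (λ x → proj₁ ∘ forcer x)
      (λ x px → forcer≢b (forcer x px))
      (λ x y px py → roundOneForcer-injective (setOfForces-functional sof) (forcer x px) (forcer y py))

  blue[]⇒∈ : ∀ {B x} → Blue G B [] x → x ∈ B
  blue[]⇒∈ (inj₁ x∈B) = x∈B

  firstForce : ∀ {B f L} → IsForceSeq G B (f ∷ L) → ∃₂ (ValidForce G B [])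
  firstForce (_∷_ {[]}    valid []) = _ , _ , valid
  firstForce (_∷_ {_ ∷ _} _ seq)    = firstForce seq

  hoppingForcingSet⇒2≤∣B∣ : (∀ v → ∃[ u ] Adj G v u) → 2 ≤ order G →
    ∀ {B} → IsHoppingForcingSet G B → 2 ≤ ∣ B ∣
  hoppingForcingSet⇒2≤∣B∣ _ 2≤n ([] , _ , allBlue) = ≤-trans 2≤n (full⇒n≤∣p∣ (blue[]⇒∈ ∘ allBlue))
  hoppingForcingSet⇒2≤∣B∣ neighbour _ (_ ∷ _ , (seq , _) , _) with firstForce seq
  ... | v , _ , v-blue , _ , _ , nbrs with neighbour v
  ... | u , adj = distinct∈⇒2≤∣p∣ (blue[]⇒∈ v-blue) (blue[]⇒∈ (nbrs u adj)) (λ { refl → Adj-irrefl G adj })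

  ptK-attained : ∀ {k t} → PtK G k t →
    ∃[ B ] ∃[ F ] (∣ B ∣ ≡ k × IsSetOfForces G B F × ∀ x → InUpTo G B F t x)
  ptK-attained ((B , ∣B∣≡k , (F , sof , covered , _) , _) , _) = B , F , ∣B∣≡k , sof , covered

isMin-1 : ∀ G {P : ℕ → Set} → P 1 → ¬ P 0 → IsMin G P 1
isMin-1 G p₁ ¬p₀ = p₁ , λ { zero p₀ → contradiction p₀ ¬p₀ ; (suc _) _ → s≤s z≤n }

boundary : ∀ {ℓ n} {P : Pred (Fin (suc n)) ℓ} → Decidable P → P zero →
  ∀ {x} → ¬ P x → ∃[ i ] (P (inject₁ i) × ¬ P (suc i))
boundary         _ p₀ {zero}  ¬px = contradiction p₀ ¬px
boundary {n = suc _} {P} P? p₀ {suc x} ¬px with P? (suc zero)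
... | no ¬p₁ = zero , p₀ , ¬p₁
... | yes p₁ = let i , pᵢ , ¬pᵢ₊₁ = boundary {P = P ∘ suc} (P? ∘ suc) p₁ ¬px in suc i , pᵢ , ¬pᵢ₊₁

path-boundaryEdge : ∀ {n} {B : Subset n} {x y} → x ∈ B → y ∉ B →
  ∃₂ λ b u → b ∈ B × u ∉ B × Adj (pathGraph n) b u
path-boundaryEdge {suc n} {B} x∈B y∉B with zero ∈? B
... | yes 0∈B =
  let i , i∈B , i+1∉B = boundary (_∈? B) 0∈B y∉B
  in inject₁ i , suc i , i∈B , i+1∉B , inj₁ (cong suc (toℕ-inject₁ i))
... | no 0∉B =
  let i , i∉B , ¬i+1∉B = boundary (λ z → ¬? (z ∈? B)) 0∉B (λ x∉B → x∉B x∈B)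
  in suc i , inject₁ i , decidable-stable (suc i ∈? B) ¬i+1∉B , i∉B , inj₂ (cong suc (toℕ-inject₁ i))

path-neighbour : ∀ {n} → 2 ≤ n → (v : Fin n) → ∃[ u ] Adj (pathGraph n) v u
path-neighbour {suc zero}    (s≤s ()) _
path-neighbour {suc (suc _)} _ zero    = suc zero , inj₁ refl
path-neighbour {suc (suc _)} _ (suc v) = inject₁ v , inj₂ (cong suc (toℕ-inject₁ v))

path-adj⇒≤suc : ∀ {n} {v u : Fin n} → Adj (pathGraph n) v u → toℕ u ≤ suc (toℕ v)
path-adj⇒≤suc (inj₁ e) = ≤-reflexive (sym e)
path-adj⇒≤suc (inj₂ e) = ≤-trans (n≤1+n _) (≤-trans (≤-reflexive e) (n≤1+n _))

prefix : (c n : ℕ) → Subset n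
prefix c       zero    = []
prefix zero    (suc n) = outside ∷ prefix zero n
prefix (suc c) (suc n) = inside ∷ prefix c n

∣prefix∣ : ∀ {c n} → c ≤ n → ∣ prefix c n ∣ ≡ c
∣prefix∣ {zero}  {zero}  _         = refl
∣prefix∣ {zero}  {suc n} _         = ∣prefix∣ {zero} {n} z≤n
∣prefix∣ {suc c} {suc n} (s≤s c≤n) = cong suc (∣prefix∣ c≤n)

∈prefix⁺ : ∀ {c n} {x : Fin n} → toℕ x < c → x ∈ prefix c n
∈prefix⁺ {suc c} {suc n} {zero}  _           = here
∈prefix⁺ {suc c} {suc n} {suc x} (s≤s x<c) = there (∈prefix⁺ x<c)

∈prefix⁻ : ∀ {c n} {x : Fin n} → x ∈ prefix c n → toℕ x < c
∈prefix⁻ {zero}  {suc n} {suc x} (there x∈) = contradiction (∈prefix⁻ {zero} {n} x∈) n≮0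
∈prefix⁻ {suc c} {suc n} {zero}  _          = s≤s z≤n
∈prefix⁻ {suc c} {suc n} {suc x} (there x∈) = s≤s (∈prefix⁻ x∈)

module PrefixForcing {c n : ℕ} where
  private
    G = pathGraph n
    B = prefix c n

    shrink : ∀ {j} → c + suc j ≤ n → c + j < n
    shrink {j} p = subst (_≤ n) (+-suc c j) p

    forcer<n : ∀ {j} → c + j < n → j < n
    forcer<n {j} p = ≤-<-trans (m≤n+m j c) p

  -- the forces i → c + i for i < j, newest first
  shiftForces : (j : ℕ) → c + j ≤ n → List (Force G)
  shiftForces zero    _ = []
  shiftForces (suc j) p = (fromℕ< (forcer<n (shrink p)) , fromℕ< (shrink p)) ∷ shiftForces j (<⇒≤ (shrink p))

  shiftForces-forcer< : ∀ j p {v} → v ∈L map proj₁ (shiftForces j p) → toℕ v < j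
  shiftForces-forcer< (suc j) _ (here refl) = s≤s (≤-reflexive (toℕ-fromℕ< _))
  shiftForces-forcer< (suc j) _ (there m)   = m≤n⇒m≤1+n (shiftForces-forcer< j _ m)

  shiftForces-forced< : ∀ j p {x} → x ∈L map proj₂ (shiftForces j p) → toℕ x < c + j
  shiftForces-forced< (suc j) _ (here refl) =
    ≤-trans (s≤s (≤-reflexive (toℕ-fromℕ< _))) (≤-reflexive (sym (+-suc c j)))
  shiftForces-forced< (suc j) _ (there m)   =
    ≤-trans (shiftForces-forced< j _ m) (+-monoʳ-≤ c (n≤1+n j))

  shiftForces-forcedBy : ∀ j p {x} → c ≤ toℕ x → toℕ x < c + j →
    ∃[ v ] ((v , x) ∈L shiftForces j p × toℕ v + c ≡ toℕ x)
  shiftForces-forcedBy zero    _ {x} c≤x x<c+0 = contradiction c≤x (<⇒≱ (subst (toℕ x <_) (+-identityʳ c) x<c+0))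
  shiftForces-forcedBy (suc j) p {x} c≤x x<c+j+1
    with m≤n⇒m<n∨m≡n (s≤s⁻¹ (≤-trans x<c+j+1 (≤-reflexive (+-suc c j))))
  ... | inj₁ x<c+j =
    let v , m , e = shiftForces-forcedBy j (<⇒≤ (shrink p)) c≤x x<c+j in v , there m , e
  ... | inj₂ x≡c+j =
    fromℕ< (forcer<n (shrink p)) , here (cong (_ ,_) (toℕ-injective (trans x≡c+j (sym (toℕ-fromℕ< _))))) ,
    trans (cong (_+ c) (toℕ-fromℕ< _)) (trans (+-comm j c) (sym x≡c+j))

  blue-below : ∀ j p {x} → toℕ x < c + j → Blue G B (shiftForces j p) x
  blue-below j p {x} x<c+j with toℕ x <? c
  ... | yes x<c = inj₁ (∈prefix⁺ x<c)
  ... | no x≮c  = inj₂ (∈-map⁺ proj₂ (proj₁ (proj₂ (shiftForces-forcedBy j p (≮⇒≥ x≮c) x<c+j))))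

  -- Since c ≥ 2, both neighbours j ± 1 of the forcer j are below c + j.
  shiftForces-valid : 2 ≤ c → ∀ j p → IsForceSeq G B (shiftForces j p)
  shiftForces-valid _   zero    _ = []
  shiftForces-valid 2≤c (suc j) p = (forcer-blue , fresh , target-white , neighbours-blue) ∷ shiftForces-valid 2≤c j _
    where
    p′ = <⇒≤ (shrink p)
    v = fromℕ< (forcer<n (shrink p))
    w = fromℕ< (shrink p)
    j+1<c+j : suc j < c + j
    j+1<c+j = +-monoˡ-≤ j 2≤c
    forcer-blue : Blue G B (shiftForces j p′) v
    forcer-blue = blue-below j p′ (subst (_< c + j) (sym (toℕ-fromℕ< _)) (<-trans (n<1+n j) j+1<c+j))
    fresh : ¬ HasForced G (shiftForces j p′) v
    fresh m = <-irrefl (toℕ-fromℕ< _) (shiftForces-forcer< j p′ m)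
    target-white : ¬ Blue G B (shiftForces j p′) w
    target-white (inj₁ w∈B) = <⇒≱ (∈prefix⁻ w∈B) (subst (c ≤_) (sym (toℕ-fromℕ< _)) (m≤m+n c j))
    target-white (inj₂ m)   = <-irrefl (toℕ-fromℕ< _) (shiftForces-forced< j p′ m)
    neighbours-blue : ∀ u → Adj G v u → Blue G B (shiftForces j p′) u
    neighbours-blue u adj =
      blue-below j p′ (≤-<-trans (≤-trans (path-adj⇒≤suc adj) (s≤s (≤-reflexive (toℕ-fromℕ< _)))) j+1<c+j)

  module _ (c≤n : c ≤ n) where
    prefixForces : List (Force G)
    prefixForces = shiftForces (n ∸ c) (≤-reflexive (m+[n∸m]≡n c≤n))

    prefixForces-allBlue : ∀ x → Blue G B prefixForces x
    prefixForces-allBlue x = blue-below _ _ (subst (toℕ x <_) (sym (m+[n∸m]≡n c≤n)) (toℕ<n x))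

    prefixForces-chron : 2 ≤ c → IsChronList G B prefixForces
    prefixForces-chron 2≤c =
      shiftForces-valid 2≤c _ _ , λ _ w (_ , _ , w-white , _) → w-white (prefixForces-allBlue w)

    -- If n < 2c, every forcer i = x − c satisfies i + 1 < c, so it and its neighbours lie in the prefix.
    prefixForces-roundOne : n < c + c → ∀ x → InUpTo G B prefixForces 1 x
    prefixForces-roundOne n<2c x with toℕ x <? c
    ... | yes x<c = inj₁ (∈prefix⁺ x<c)
    ... | no x≮c  =
      let v , m , v+c≡x = shiftForces-forcedBy _ _ (≮⇒≥ x≮c) (subst (toℕ x <_) (sym (m+[n∸m]≡n c≤n)) (toℕ<n x))
          v+1<c : suc (toℕ v) < c
          v+1<c = +-cancelʳ-≤ c _ _ (≤-trans (s≤s (s≤s (≤-reflexive v+c≡x))) (≤-trans (s≤s (toℕ<n x)) n<2c))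
      in inj₂ (v , m , ∈prefix⁺ (<-trans (n<1+n _) v+1<c) , (λ x∈B → x≮c (∈prefix⁻ x∈B)) ,
               λ u adj → ∈prefix⁺ (≤-<-trans (path-adj⇒≤suc adj) v+1<c))

open PrefixForcing

path-HNum≡2 : ∀ {n} → 2 ≤ n → HNum (pathGraph n) 2
path-HNum≡2 {n} 2≤n =
  (prefix 2 n , ∣prefix∣ 2≤n , prefixForces 2≤n , prefixForces-chron 2≤n ≤-refl , prefixForces-allBlue 2≤n) ,
  λ { _ (_ , refl , forcing) → hoppingForcingSet⇒2≤∣B∣ (path-neighbour 2≤n) 2≤n forcing }

path-ptK≡1 : ∀ {c n} → 2 ≤ c → c < n → n < c + c → PtK (pathGraph n) c 1
path-ptK≡1 {c} {n} 2≤c c<n n<2c =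
  isMin-1 (pathGraph n) (prefix c n , ∣prefix∣ c≤n , ptSet)
    (λ (_ , ∣B∣≡c , (_ , _ , covered , _) , _) → ∣p∣<n⇒¬full (subst (_< n) (sym ∣B∣≡c) c<n) covered)
  where
  c≤n = <⇒≤ c<n
  ∣prefix∣<n : ∣ prefix c n ∣ < n
  ∣prefix∣<n = subst (_< n) (sym (∣prefix∣ c≤n)) c<n
  ptSet : PtSet (pathGraph n) (prefix c n) 1
  ptSet = isMin-1 (pathGraph n)
    (prefixForces c≤n , (prefixForces c≤n , prefixForces-chron c≤n 2≤c , λ _ → mk⇔ id id) ,
     isMin-1 (pathGraph n) (prefixForces-roundOne c≤n n<2c) (∣p∣<n⇒¬full ∣prefix∣<n))
    (λ (_ , _ , covered , _) → ∣p∣<n⇒¬full ∣prefix∣<n covered)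

n≤[3+s]k⇒n<k[2+s]+k[2+s] : ∀ {n k} s → 0 < n → n ≤ (3 + s) * k → n < k * (2 + s) + k * (2 + s)
n≤[3+s]k⇒n<k[2+s]+k[2+s] {k = zero}  s 0<n n≤0 = contradiction (≤-trans n≤0 (≤-reflexive (*-zeroʳ (3 + s)))) (<⇒≱ 0<n)
n≤[3+s]k⇒n<k[2+s]+k[2+s] {n} {suc k} s _ n≤[3+s]k = begin-strict
  n                                          <⟨ +-mono-≤ (s≤s z≤n) n≤[3+s]k ⟩
  suc s * suc k + (3 + s) * suc k            ≡⟨ double k s ⟨
  suc k * (2 + s) + suc k * (2 + s)          ∎
  where
  open ≤-Reasoning
  double : ∀ k s → suc k * (2 + s) + suc k * (2 + s) ≡ suc s * suc k + (3 + s) * suc k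
  double = solve-∀

path-throttle-lowerBound : ∀ {n B F} t → ∣ B ∣ < n → IsSetOfForces (pathGraph n) B F →
  (∀ x → InUpTo (pathGraph n) B F t x) → n < ∣ B ∣ * t + ∣ B ∣ * t
path-throttle-lowerBound zero ∣B∣<n _ covered = contradiction covered (∣p∣<n⇒¬full ∣B∣<n)
path-throttle-lowerBound {n} {B} (suc zero) ∣B∣<n sof covered =
  let w , w∉B = ¬∀⟶∃¬ n (_∈ B) (_∈? B) (∣p∣<n⇒¬full ∣B∣<n)
      _ , _ , v∈B , _ = roundOneForcer {G = pathGraph n} (covered w) w∉B
      _ , _ , b∈B , u∉B , adj = path-boundaryEdge v∈B w∉B
  in subst (λ k → n < k + k) (sym (*-identityʳ ∣ B ∣)) (order<∣B∣+∣B∣ sof covered b∈B adj u∉B)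
path-throttle-lowerBound {B = B} (suc (suc s)) ∣B∣<n sof covered =
  n≤[3+s]k⇒n<k[2+s]+k[2+s] {k = ∣ B ∣} s (≤-<-trans z≤n ∣B∣<n) (order≤rounds*∣B∣ sof covered)

⌈n/2⌉≤m : ∀ {n m} → n ≤ m + m → ⌈ n /2⌉ ≤ m
⌈n/2⌉≤m {m = m} n≤2m = ≤-trans (⌈n/2⌉-mono n≤2m) (≤-reflexive (sym (n≡⌈n+n/2⌉ m)))

n≤⌈n/2⌉+⌈n/2⌉ : ∀ n → n ≤ ⌈ n /2⌉ + ⌈ n /2⌉
n≤⌈n/2⌉+⌈n/2⌉ n = subst (_≤ ⌈ n /2⌉ + ⌈ n /2⌉) (⌊n/2⌋+⌈n/2⌉≡n n) (+-monoˡ-≤ ⌈ n /2⌉ (⌊n/2⌋≤⌈n/2⌉ n))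

⌈1+n/2⌉<n : ∀ {n} → 3 ≤ n → ⌈ suc n /2⌉ < n
⌈1+n/2⌉<n {suc (suc (suc m))} _ = s≤s (s≤s (s≤s (⌈n/2⌉≤n m)))
⌈1+n/2⌉<n {suc zero}       (s≤s ())
⌈1+n/2⌉<n {suc (suc zero)} (s≤s (s≤s ()))

proposition4p12 : (n : ℕ) → 3 ≤ n → ThStarH (pathGraph n) ⌈ suc n /2⌉
proposition4p12 n 3≤n =
  (K , 2 , 1 , path-HNum≡2 (≤-trans (n≤1+n 2) 3≤n) , 2≤K , K<n , path-ptK≡1 2≤K K<n n<K+K , sym (*-identityʳ K)) ,
  λ { _ (k , _ , t , _ , _ , k<n , ptK , refl) → lowerBound k t k<n ptK }
  where
  K = ⌈ suc n /2⌉
  2≤K : 2 ≤ K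
  2≤K = ⌈n/2⌉-mono (s≤s 3≤n)
  K<n : K < n
  K<n = ⌈1+n/2⌉<n 3≤n
  n<K+K : n < K + K
  n<K+K = n≤⌈n/2⌉+⌈n/2⌉ (suc n)
  lowerBound : ∀ k t → k < n → PtK (pathGraph n) k t → K ≤ k * t
  lowerBound k t k<n ptK with _ , _ , refl , sof , covered ← ptK-attained {G = pathGraph n} ptK =
    ⌈n/2⌉≤m (path-throttle-lowerBound t k<n sof covered)
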